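{- Let $G$ be a connected graph and let $r$ be a simple ribbon of $G$ which is an edge cut. Then $G\setminus r=(V_G,E_G\setminus r)$ has exactly two connected components. In particular, if $w,w'\in V_G$ and $W$ is a walk from $w$ to $w'$, then $|r\cap W|$ is odd if and only if $w$ and $w'$ lie in different connected components of $G\setminus r$.
   Context: For a graph $G$, two edges are related if they are opposite edges of a 4-cycle subgraph of $G$; a ribbon is an equivalence class of the reflexive–transitive closure of this relation. A ribbon $r$ is simple if the subgraph induced by the edges of $r$ contains no 4-cycle. A set of edges $r$ is an edge cut of a connected graph $G$ if $(V_G,E_G\setminus r)$ is disconnected. For a walk $W$, $|r\cap W|$ denotes the number of edges of $W$ lying in $r$, counted with multiplicity (each traversal counted). -}

module Defs where

open import Data.Bool using (Bool; true; false; not)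
open import Data.Empty using (⊥)
open import Data.Product using (Σ; Σ-syntax; _×_; _,_)
open import Data.Sum using (_⊎_)
open import Relation.Nullary using (¬_)
open import Relation.Binary.PropositionalEquality using (_≡_)
open import Relation.Binary.Construct.Closure.ReflexiveTransitive
  using (Star; ε; _◅_)

-- A (simple, possibly infinite) graph: vertex type with a symmetric,
-- irreflexive adjacency relation.  An edge {x,y} is represented by
-- either of its orientations (x , y) with x ~ y.
record Graph : Set₁ where
  field
    V      : Set
    _~_    : V → V → Set
    ~-sym  : ∀ {x y} → x ~ y → y ~ x
    ~-irr  : ∀ {x} → ¬ (x ~ x)

module _ (G : Graph) where
  open Graph G

  Walk : V → V → Set
  Walk = Star _~_

  Connected : Set
  Connected = ∀ x y → Walk x y

  FourCycle : (V → V → Set) → V → V → V → V → Set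
  FourCycle E a b c d =
    E a b × E b c × E c d × E d a ×
    ¬ a ≡ b × ¬ a ≡ c × ¬ a ≡ d × ¬ b ≡ c × ¬ b ≡ d × ¬ c ≡ d

  Opposite : V × V → V × V → Set
  Opposite p q = Σ[ a ∈ V ] Σ[ b ∈ V ] Σ[ c ∈ V ] Σ[ d ∈ V ]
    (FourCycle _~_ a b c d × p ≡ (a , b) × q ≡ (c , d))

  Flip : V × V → V × V → Set
  Flip (x , y) q = q ≡ (y , x)

  -- Generating relation on oriented edges; its reflexive-transitive
  -- closure is the ribbon equivalence on (unordered) edges.
  RibbonStep : V × V → V × V → Set
  RibbonStep p q = Opposite p q ⊎ Flip p q

  -- The ribbon containing the edge (u,v): the set of edges {x,y}
  -- equivalent to {u,v}  (as a symmetric predicate on orientations).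
  RibbonOf : V → V → (V → V → Set)
  RibbonOf u v x y = x ~ y × Star RibbonStep (u , v) (x , y)

  SimpleRibbon : (V → V → Set) → Set
  SimpleRibbon r = ¬ (Σ[ a ∈ V ] Σ[ b ∈ V ] Σ[ c ∈ V ] Σ[ d ∈ V ]
    FourCycle r a b c d)

  Minus : (V → V → Set) → V → V → Set
  Minus r x y = x ~ y × ¬ r x y

  ConnIn : (V → V → Set) → V → V → Set
  ConnIn r = Star (Minus r)

  EdgeCut : (V → V → Set) → Set
  EdgeCut r = Σ[ x ∈ V ] Σ[ y ∈ V ] ¬ ConnIn r x y

  ExactlyTwoComponents : (V → V → Set) → Set
  ExactlyTwoComponents r =
    (Σ[ x ∈ V ] Σ[ y ∈ V ] ¬ ConnIn r x y) ×
    (∀ x y z → ¬ ConnIn r x y → ¬ ConnIn r y z → ¬ ConnIn r x z → ⊥)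

  -- CrossParity r W b : the number |r ∩ W| of traversals of edges of r
  -- by the walk W (with multiplicity) has parity b (true = odd).
  data CrossParity (r : V → V → Set) : {x y : V} → Walk x y → Bool → Set where
    nil   : ∀ {x} → CrossParity r {x} {x} ε false
    consᵢ : ∀ {x y z} {e : x ~ y} {W : Walk y z} {b} →
            r x y → CrossParity r W b → CrossParity r (e ◅ W) (not b)
    consₒ : ∀ {x y z} {e : x ~ y} {W : Walk y z} {b} →
            ¬ r x y → CrossParity r W b → CrossParity r (e ◅ W) b

module Submission where

-- Let r be the ribbon of the edge uv and call the two
-- endpoints u and v the poles.  Say a vertex x lies on side s (a Bool)
-- when it is joined to the pole of side s by a walk avoiding r.
--
-- 1. Every ribbon edge straddles: its endpoints lie on opposite sides.
--    This holds for uv itself and is preserved along the ribbon relation: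
--    if ab, cd are opposite edges of a 4-cycle abcd with ab, cd in r, then
--    bc and da are not in r (else r would contain the 4-cycle abcd,
--    contradicting simplicity), so d is on the side of a and c on the side
--    of b.
-- 2. Hence walking along any edge, a vertex that has a side leads to one
--    that has a side; in a connected graph every vertex (doubly negated,
--    since membership in r is not decidable) lies on some side.  So G ∖ r
--    has at most two components, and since r is a cut, u and v are not
--    connected in G ∖ r: the sides are distinct components.
-- 3. With the poles separated, sides are unique, so crossing an edge of r
--    flips the side and other edges keep it.  Following a walk, the side
--    changes by the parity of |r ∩ W|, which gives the parity criterion.
--
-- Note that the
-- argument never uses that u and v are adjacent.

open import Defs
open import Data.Bool using (Bool; true; false; not; _xor_)
open import Data.Bool.Properties
  using (not-involutive; not-¬; xor-identityʳ; xor-comm; true-xor;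
         not-distribˡ-xor; not-distribʳ-xor)
open import Data.Product using (Σ; _×_; _,_)
open import Data.Sum using (_⊎_; inj₁; inj₂)
open import Data.Empty using (⊥; ⊥-elim)
open import Function using (_∘_)
open import Function.Bundles using (_⇔_; mk⇔)
open import Relation.Nullary using (¬_; Dec; yes; no)
open import Relation.Nullary.Decidable using (¬¬-excluded-middle)
open import Relation.Binary.PropositionalEquality
  using (_≡_; refl; sym; trans; subst)
open import Relation.Binary.Construct.Closure.ReflexiveTransitive
  using (Star; ε; _◅_; _◅◅_; reverse; return)

bool-pigeonhole : ∀ (a b c : Bool) → a ≡ b ⊎ b ≡ c ⊎ a ≡ c
bool-pigeonhole false false _     = inj₁ refl
bool-pigeonhole true  true  _     = inj₁ refl
bool-pigeonhole false true  true  = inj₂ (inj₁ refl)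
bool-pigeonhole true  false false = inj₂ (inj₁ refl)
bool-pigeonhole false true  false = inj₂ (inj₂ refl)
bool-pigeonhole true  false true  = inj₂ (inj₂ refl)

xor-true : ∀ s → s xor true ≡ not s
xor-true s = trans (xor-comm s true) (true-xor s)

module FourCycles (G : Graph) where
  open Graph G

  rotate : ∀ {E : V → V → Set} {a b c d} →
    FourCycle G E a b c d → FourCycle G E b c d a
  rotate (ab , bc , cd , da , a≢b , a≢c , a≢d , b≢c , b≢d , c≢d) =
    bc , cd , da , ab , b≢c , b≢d , a≢b ∘ sym , c≢d , a≢c ∘ sym , a≢d ∘ sym

module RibbonCut (G : Graph) (u v : Graph.V G) where
  open Graph G
  open FourCycles G

  r : V → V → Set
  r = RibbonOf G u v

  Conn : V → V → Set
  Conn = ConnIn G r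

  ribbon-flip : ∀ {x y} → r x y → r y x
  ribbon-flip (e , path) = ~-sym e , path ◅◅ return (inj₂ refl)

  conn-sym : ∀ {x y} → Conn x y → Conn y x
  conn-sym = reverse λ (e , x∉r) → ~-sym e , x∉r ∘ ribbon-flip

  ribbon-opposite : ∀ {a b c d} → FourCycle G _~_ a b c d →
    Star (RibbonStep G) (u , v) (a , b) → Star (RibbonStep G) (u , v) (c , d)
  ribbon-opposite cyc path = path ◅◅ return (inj₁ (_ , _ , _ , _ , cyc , refl , refl))

  pole : Bool → V
  pole false = u
  pole true  = v

  Side : Bool → V → Set
  Side s x = Conn (pole s) x

  HasSide : V → Set
  HasSide x = Σ Bool λ s → Side s x

  Straddles : V × V → Set
  Straddles (x , y) = Σ Bool λ s → Side s x × Side (not s) y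

  side-step : ∀ {s x y} → Side s x → Minus G r x y → Side s y
  side-step sx m = sx ◅◅ return m

  same-side-conn : ∀ {s x y} → Side s x → Side s y → Conn x y
  same-side-conn sx sy = conn-sym sx ◅◅ sy

  straddles-swap : ∀ {x y} → Straddles (x , y) → Straddles (y , x)
  straddles-swap (s , sx , sy) =
    not s , sy , subst (λ t → Side t _) (sym (not-involutive s)) sx

  module _ (simple : SimpleRibbon G r) where

    -- In a 4-cycle abcd with ab and cd in a simple ribbon, bc is not in it:
    -- otherwise da, being opposite to bc, is too and r contains abcd.
    rung-outside : ∀ {a b c d} → FourCycle G _~_ a b c d →
      r a b → r c d → ¬ r b c
    rung-outside {a} {b} {c} {d}
      cyc@(_ , _ , _ , da , a≢b , a≢c , a≢d , b≢c , b≢d , c≢d)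
      rab rcd rbc@(_ , path) =
      simple (a , b , c , d , rab , rbc , rcd , rda ,
              a≢b , a≢c , a≢d , b≢c , b≢d , c≢d)
      where
      rda : r d a
      rda = da , ribbon-opposite (rotate cyc) path

    -- Step 1: every edge of the ribbon straddles the two sides.  We walk
    -- along the ribbon chain from uv, remembering the chain so far (which
    -- shows that the current edge lies in r).
    ribbon-straddles : ∀ {x y} → r x y → Straddles (x , y)
    ribbon-straddles (_ , chain) = along ε (false , ε , ε) chain
      where
      extend : ∀ {p q} → Star (RibbonStep G) (u , v) p → Straddles p →
        RibbonStep G p q → Straddles q
      extend _ st (inj₂ refl) = straddles-swap st
      extend path (s , sa , sb)
        (inj₁ (a , b , c , d , cyc@(ab , bc , cd , da , _) , refl , refl)) =
        straddles-swap (s , side-step sa ad∉r , side-step sb bc∉r)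
        where
        -- d stays on the side of a, c on the side of b.
        rab : r a b
        rab = ab , path
        rcd : r c d
        rcd = cd , ribbon-opposite cyc path
        bc∉r : Minus G r b c
        bc∉r = bc , rung-outside cyc rab rcd
        ad∉r : Minus G r a d
        ad∉r = ~-sym da , rung-outside (rotate (rotate cyc)) rcd rab ∘ ribbon-flip

      along : ∀ {p q} → Star (RibbonStep G) (u , v) p → Straddles p →
        Star (RibbonStep G) p q → Straddles q
      along _    st ε             = st
      along path st (step ◅ rest) =
        along (path ◅◅ return step) (extend path st step) rest

    -- Step 2: having a side propagates along walks (doubly negated, as we
    -- must decide whether each edge lies in r).
    walk-sides : ∀ {x y} → Walk G x y → HasSide x → ¬ ¬ HasSide y
    walk-sides ε h k = k h
    walk-sides {x} (_◅_ {j = y} e W) (s , sx) k =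
      ¬¬-excluded-middle λ r? → walk-sides W (next r?) k
      where
      next : Dec (r x y) → HasSide y
      next (yes rxy) with ribbon-straddles rxy
      ... | t , _ , ty = not t , ty
      next (no x∉r)  = s , side-step sx (e , x∉r)

    module _ (conn : Connected G) where

      every-vertex-sided : ∀ x → ¬ ¬ HasSide x
      every-vertex-sided x = walk-sides (conn u x) (false , ε)

      at-most-two : ∀ x y z → ¬ Conn x y → ¬ Conn y z → ¬ Conn x z → ⊥
      at-most-two x y z x≁y y≁z x≁z =
        every-vertex-sided x λ (s₁ , sx) →
        every-vertex-sided y λ (s₂ , sy) →
        every-vertex-sided z λ (s₃ , sz) →
        two-alike sx sy sz (bool-pigeonhole s₁ s₂ s₃)
        where
        two-alike : ∀ {s₁ s₂ s₃} → Side s₁ x → Side s₂ y → Side s₃ z →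
          s₁ ≡ s₂ ⊎ s₂ ≡ s₃ ⊎ s₁ ≡ s₃ → ⊥
        two-alike sx sy _  (inj₁ refl)        = x≁y (same-side-conn sx sy)
        two-alike _  sy sz (inj₂ (inj₁ refl)) = y≁z (same-side-conn sy sz)
        two-alike sx _  sz (inj₂ (inj₂ refl)) = x≁z (same-side-conn sx sz)

      -- If the poles were connected in G ∖ r, so would be every vertex;
      -- hence a cut separates u from v.
      cut-separates-poles : EdgeCut G r → ¬ Conn u v
      cut-separates-poles (x , y , x≁y) u∼v =
        every-vertex-sided x λ (s , sx) →
        every-vertex-sided y λ (t , ty) →
        x≁y (conn-sym (from-u s sx) ◅◅ from-u t ty)
        where
        from-u : ∀ s {z} → Side s z → Conn u z
        from-u false p = p
        from-u true  p = u∼v ◅◅ p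

    module _ (apart : ¬ Conn u v) where

      side-unique : ∀ {s t x} → Side s x → Side t x → s ≡ t
      side-unique {false} {false} _  _  = refl
      side-unique {true}  {true}  _  _  = refl
      side-unique {false} {true}  ux vx = ⊥-elim (apart (ux ◅◅ conn-sym vx))
      side-unique {true}  {false} vx ux = ⊥-elim (apart (ux ◅◅ conn-sym vx))

      opposite-sides-apart : ∀ {s x y} → Side s x → Side (not s) y → ¬ Conn x y
      opposite-sides-apart sx sy x∼y =
        not-¬ refl (side-unique sx (sy ◅◅ conn-sym x∼y))

      crossing-flips : ∀ {s x y} → r x y → Side s x → Side (not s) y
      crossing-flips {y = y} rxy sx with ribbon-straddles rxy
      ... | t , tx , ty = subst (λ t′ → Side (not t′) y) (side-unique tx sx) ty

      walk-parity : ∀ {w w′ s b} {W : Walk G w w′} →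
        CrossParity G r W b → Side s w → Side (s xor b) w′
      walk-parity {s = s} nil sw =
        subst (λ t → Side t _) (sym (xor-identityʳ s)) sw
      walk-parity {s = s} (consᵢ {b = b} rxy cp) sw =
        subst (λ t → Side t _)
          (trans (sym (not-distribˡ-xor s b)) (not-distribʳ-xor s b))
          (walk-parity cp (crossing-flips rxy sw))
      walk-parity (consₒ {e = e} x∉r cp) sw =
        walk-parity cp (side-step sw (e , x∉r))

      parity-criterion : Connected G →
        ∀ {w w′ b} {W : Walk G w w′} → CrossParity G r W b →
        (b ≡ true) ⇔ (¬ Conn w w′)
      parity-criterion conn {w} {w′} cp = mk⇔ (odd⇒apart cp) (apart⇒odd cp)
        where
        odd⇒apart : ∀ {b} {W : Walk G w w′} → CrossParity G r W b →
          b ≡ true → ¬ Conn w w′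
        odd⇒apart cp′ refl w∼w′ = every-vertex-sided conn w λ (s , sw) →
          opposite-sides-apart sw
            (subst (λ t → Side t w′) (xor-true s) (walk-parity cp′ sw)) w∼w′

        apart⇒odd : ∀ {b} {W : Walk G w w′} → CrossParity G r W b →
          ¬ Conn w w′ → b ≡ true
        apart⇒odd {true}  _   _     = refl
        apart⇒odd {false} cp′ w≁w′ =
          ⊥-elim (every-vertex-sided conn w λ (s , sw) →
            w≁w′ (same-side-conn sw
              (subst (λ t → Side t w′) (xor-identityʳ s) (walk-parity cp′ sw))))

lemma3p2 : (G : Graph) → Connected G →
    ∀ (u v : Graph.V G) → Graph._~_ G u v →
    SimpleRibbon G (RibbonOf G u v) →
    EdgeCut G (RibbonOf G u v) →
    ExactlyTwoComponents G (RibbonOf G u v) ×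
    (∀ (w w' : Graph.V G) (W : Walk G w w') (b : Bool) →
      CrossParity G (RibbonOf G u v) W b →
      ((b ≡ true) ⇔ (¬ ConnIn G (RibbonOf G u v) w w')))
lemma3p2 G conn u v _ simple cut =
  (cut , at-most-two simple conn) ,
  λ _ _ _ _ → parity-criterion simple apart conn
  where
  open RibbonCut G u v
  apart : ¬ Conn u v
  apart = cut-separates-poles simple conn cut
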